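{- Let $\Pi\,\phi$ be a true S-form DQBF. Let $\alpha$ be a conjunction of universal literals (over universal variables of $\Pi$), let $Y$ be a set of literals over variables of $\Pi$, let $b$ be a Boolean function on $Y$, and let $v$ be a fresh variable not occurring in $\Pi$ or $\phi$, with dependency set $D_v=\big(\bigcup_{y\in Y}D_{\mathrm{var}(y)}\big)\setminus\mathrm{var}(\alpha)$. Then the S-form DQBF $\Pi\,\exists v(D_v)\;\phi\wedge(\alpha\rightarrow(v\leftrightarrow b(Y)))$ is true.
   Context: An S-form DQBF is a formula $\forall U\exists E\,\psi$ (with prefix written $\Pi$) where $U$ is a finite set of universal variables, $E$ a finite set of existential variables, each $x\in E$ carries a dependency set $D_x\subseteq U$, and $\psi$ is a quantifier-free propositional formula over $U\cup E$. For a universal variable $u$ one sets $D_u=\{u\}$; $\mathrm{var}(\alpha)$ is the set of variables occurring in $\alpha$. The DQBF is true iff there are functions $f_x:\{0,1\}^{D_x}\to\{0,1\}$ for $x\in E$ such that for every assignment $\tau$ to $U$, $\tau$ extended by $x\mapsto f_x(\tau|_{D_x})$ satisfies $\psi$. $\Pi\,\exists v(D_v)$ denotes the prefix $\Pi$ extended by the existential variable $v$ with dependency set $D_v$. -}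

module Defs where

open import Data.Nat using (ℕ; _≟_)
open import Data.Bool using (Bool; true; false; not; _∧_; _∨_; if_then_else_)
open import Data.List using (List; []; _∷_; map; _++_; concatMap; filter; length; all)
open import Data.Vec using (Vec; []; _∷_)
open import Data.Product using (_×_; _,_; proj₁; proj₂; Σ)
open import Data.Maybe using (Maybe; just; nothing)
open import Relation.Nullary using (¬_; does; ¬?)
open import Relation.Binary.PropositionalEquality using (_≡_)
open import Data.List.Membership.Propositional using (_∈_; _∉_)
open import Data.List.Membership.DecPropositional _≟_ using (_∈?_)
open import Data.List.Relation.Unary.Unique.Propositional using (Unique)

Var : Set
Var = ℕ

data Form : Set where
  var  : Var → Form
  tt   : Form
  ff   : Form
  neg  : Form → Form
  _and_ : Form → Form → Form
  _or_  : Form → Form → Form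
  _imp_ : Form → Form → Form
  _iff_ : Form → Form → Form

vars : Form → List Var
vars (var x)   = x ∷ []
vars tt        = []
vars ff        = []
vars (neg f)   = vars f
vars (f and g) = vars f ++ vars g
vars (f or g)  = vars f ++ vars g
vars (f imp g) = vars f ++ vars g
vars (f iff g) = vars f ++ vars g

Assignment : Set
Assignment = Var → Bool

eval : Assignment → Form → Bool
eval σ (var x)   = σ x
eval σ tt        = true
eval σ ff        = false
eval σ (neg f)   = not (eval σ f)
eval σ (f and g) = eval σ f ∧ eval σ g
eval σ (f or g)  = eval σ f ∨ eval σ g
eval σ (f imp g) = not (eval σ f) ∨ eval σ g
eval σ (f iff g) = if eval σ f then eval σ g else not (eval σ g)

data Lit : Set where
  pos : Var → Lit
  ngt : Var → Lit

litVar : Lit → Var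
litVar (pos x) = x
litVar (ngt x) = x

litForm : Lit → Form
litForm (pos x) = var x
litForm (ngt x) = neg (var x)

conj : List Lit → Form
conj []      = tt
conj (l ∷ ls) = litForm l and conj ls

-- The formula b(Y): a Boolean function b on the (ordered) list of literals Y,
-- applied to the values of the literals, written as a propositional formula
-- via Shannon expansion.
applyFn : (Y : List Lit) → (Vec Bool (length Y) → Bool) → Form
applyFn [] b = if b [] then tt else ff
applyFn (l ∷ Y) b =
  (litForm l and applyFn Y (λ bs → b (true ∷ bs)))
  or (neg (litForm l) and applyFn Y (λ bs → b (false ∷ bs)))

record Prefix : Set where
  constructor mkPrefix
  field
    univ  : List Var
    exist : List (Var × List Var)
open Prefix public

evars : Prefix → List Var
evars Π = map proj₁ (exist Π)

allVars : Prefix → List Var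
allVars Π = univ Π ++ evars Π

extendPrefix : Prefix → Var → List Var → Prefix
extendPrefix Π v D = mkPrefix (univ Π) (exist Π ++ ((v , D) ∷ []))

-- Dependency set D_x (D_u = {u} for universal / non-existential variables).
lookupDep : List (Var × List Var) → Var → Maybe (List Var)
lookupDep [] x = nothing
lookupDep ((y , D) ∷ es) x = if does (x ≟ y) then just D else lookupDep es x

dep : Prefix → Var → List Var
dep Π x with lookupDep (exist Π) x
... | just D  = D
... | nothing = x ∷ []

_⊆_ : List Var → List Var → Set
xs ⊆ ys = ∀ {x} → x ∈ xs → x ∈ ys

WellFormed : Prefix → Form → Set
WellFormed Π ψ =
  Unique (allVars Π)
  × (∀ {x D} → (x , D) ∈ exist Π → D ⊆ univ Π)
  × (vars ψ ⊆ allVars Π)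

DependsOnlyOn : List Var → (Assignment → Bool) → Set
DependsOnlyOn D g = ∀ τ τ' → (∀ {u} → u ∈ D → τ u ≡ τ' u) → g τ ≡ g τ'

extendAssign : Prefix → (Var → Assignment → Bool) → Assignment → Assignment
extendAssign Π F τ x = if does (x ∈? evars Π) then F x τ else τ x

-- Truth of the DQBF Π ψ: there are Skolem functions f_x : {0,1}^{D_x} → {0,1}
-- (functions of the assignment depending only on D_x) such that every
-- universal assignment, extended by them, satisfies ψ.
DQBFTrue : Prefix → Form → Set
DQBFTrue Π ψ =
  Σ (Var → Assignment → Bool) λ F →
    (∀ {x D} → (x , D) ∈ exist Π → DependsOnlyOn D (F x))
    × (∀ (τ : Assignment) → eval (extendAssign Π F τ) ψ ≡ true)

newDep : Prefix → List Lit → List Lit → List Var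
newDep Π α Y =
  filter (λ u → ¬? (u ∈? map litVar α)) (concatMap (λ y → dep Π (litVar y)) Y)

-- Take the Skolem functions F of Π φ and let v copy the value of b(Y) that F
-- produces after the universal assignment has been overwritten on var(α) so
-- that α holds. The overwritten variables are then constants, so this value
-- depends only on the union of the D_var(y) minus var(α), which is D_v; and
-- whenever α already holds the overwriting changes nothing, so v ↔ b(Y) holds
-- under the extended assignment. The old Skolem functions still satisfy φ
-- because v is fresh.
module Submission where

open import Defs
open import Data.Bool using (Bool; true; false; not; _∧_; _∨_; if_then_else_)
open import Data.List using (List; []; _∷_; _++_; map; length)
open import Data.List.Properties using (map-++)
open import Data.List.Membership.Propositional using (_∈_; _∉_; lose)
open import Data.List.Membership.Propositional.Properties
  using (∈-++⁺ˡ; ∈-++⁺ʳ; ∈-++⁻; ∈-map⁺; ∈-map⁻; ∈-filter⁺; ∈-concatMap⁺)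
open import Data.Nat using (_≟_)
open import Data.List.Membership.DecPropositional _≟_ using (_∈?_)
open import Data.List.Relation.Unary.Any using (here; there)
import Data.List.Relation.Unary.All as All
import Data.List.Relation.Unary.All.Properties as All
open import Data.List.Relation.Unary.AllPairs using (_∷_)
open import Data.List.Relation.Unary.Unique.Propositional using (Unique)
open import Data.Maybe using (just; nothing)
open import Data.Product using (_,_; proj₁; ∃)
open import Data.Sum using (_⊎_; inj₁; inj₂; [_,_]′)
open import Data.Vec using (Vec; [])
open import Function using (_∘_)
open import Relation.Nullary using (does; yes; no; ¬?; contradiction)
open import Relation.Nullary.Decidable using (dec-true; dec-false)
open import Relation.Binary.PropositionalEquality

eval-cong : ∀ f {σ σ′ : Assignment} → (∀ {x} → x ∈ vars f → σ x ≡ σ′ x) →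
            eval σ f ≡ eval σ′ f
eval-cong (var x)   h = h (here refl)
eval-cong tt        h = refl
eval-cong ff        h = refl
eval-cong (neg f)   h = cong not (eval-cong f h)
eval-cong (f and g) h =
  cong₂ _∧_ (eval-cong f (h ∘ ∈-++⁺ˡ)) (eval-cong g (h ∘ ∈-++⁺ʳ (vars f)))
eval-cong (f or g)  h =
  cong₂ _∨_ (eval-cong f (h ∘ ∈-++⁺ˡ)) (eval-cong g (h ∘ ∈-++⁺ʳ (vars f)))
eval-cong (f imp g) h =
  cong₂ (λ a c → not a ∨ c) (eval-cong f (h ∘ ∈-++⁺ˡ)) (eval-cong g (h ∘ ∈-++⁺ʳ (vars f)))
eval-cong (f iff g) h =
  cong₂ (λ a c → if a then c else not c)
        (eval-cong f (h ∘ ∈-++⁺ˡ)) (eval-cong g (h ∘ ∈-++⁺ʳ (vars f)))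

∈-vars-litForm : ∀ l {x} → x ∈ vars (litForm l) → x ≡ litVar l
∈-vars-litForm (pos _) (here x≡l) = x≡l
∈-vars-litForm (ngt _) (here x≡l) = x≡l

vars-conj : ∀ α → vars (conj α) ⊆ map litVar α
vars-conj (l ∷ α) m with ∈-++⁻ (vars (litForm l)) m
... | inj₁ p = here (∈-vars-litForm l p)
... | inj₂ p = there (vars-conj α p)

vars-applyFn : ∀ Y b → vars (applyFn Y b) ⊆ map litVar Y
vars-applyFn []      b m with b []
vars-applyFn []      b () | true
vars-applyFn []      b () | false
vars-applyFn (l ∷ Y) b m =
  [ branch _ , branch _ ]′ (∈-++⁻ (vars (litForm l) ++ vars (applyFn Y _)) m)
  where
  branch : ∀ b′ → (vars (litForm l) ++ vars (applyFn Y b′)) ⊆ map litVar (l ∷ Y)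
  branch b′ p with ∈-++⁻ (vars (litForm l)) p
  ... | inj₁ q = here (∈-vars-litForm l q)
  ... | inj₂ q = there (vars-applyFn Y b′ q)

map-litVar-⊆ : ∀ {ls xs} → (∀ {l} → l ∈ ls → litVar l ∈ xs) → map litVar ls ⊆ xs
map-litVar-⊆ h m with ∈-map⁻ litVar m
... | _ , l∈ls , refl = h l∈ls

Unique-++⇒disjoint : ∀ (xs ys : List Var) → Unique (xs ++ ys) → ∀ {u} → u ∈ xs → u ∉ ys
Unique-++⇒disjoint (x ∷ xs) ys (x≢ ∷ _) (here refl) x∈ys = All.lookup (All.++⁻ʳ xs x≢) x∈ys refl
Unique-++⇒disjoint (x ∷ xs) ys (_ ∷ !) (there p) = Unique-++⇒disjoint xs ys ! p

lookupDep-sound : ∀ es x {D} → lookupDep es x ≡ just D → (x , D) ∈ es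
lookupDep-sound ((y , D′) ∷ es) x eq with x ≟ y
... | yes refl rewrite dec-true (x ≟ x) refl with refl ← eq = here refl
... | no x≢y   rewrite dec-false (x ≟ y) x≢y = there (lookupDep-sound es x eq)

lookupDep-complete : ∀ es x → x ∈ map proj₁ es → ∃ λ D → lookupDep es x ≡ just D
lookupDep-complete ((y , D) ∷ es) x m with x ≟ y
... | yes x≡y rewrite dec-true (x ≟ y) x≡y = D , refl
lookupDep-complete ((y , D) ∷ es) x (here x≡y) | no x≢y = contradiction x≡y x≢y
lookupDep-complete ((y , D) ∷ es) x (there m)  | no x≢y
  rewrite dec-false (x ≟ y) x≢y = lookupDep-complete es x m

dep-∈-exist : ∀ Π {x} → x ∈ evars Π → (x , dep Π x) ∈ exist Π
dep-∈-exist Π {x} x∈E with lookupDep (exist Π) x in eq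
... | just D  = lookupDep-sound (exist Π) x eq
... | nothing with lookupDep-complete (exist Π) x x∈E
...   | D , eq′ with () ← trans (sym eq) eq′

dep-∉ : ∀ Π {x} → x ∉ evars Π → dep Π x ≡ x ∷ []
dep-∉ Π {x} x∉E with lookupDep (exist Π) x in eq
... | just D  = contradiction (∈-map⁺ proj₁ (lookupDep-sound (exist Π) x eq)) x∉E
... | nothing = refl

extendAssign-univ : ∀ Π F τ → Unique (allVars Π) → ∀ {u} → u ∈ univ Π → extendAssign Π F τ u ≡ τ u
extendAssign-univ Π F τ unique {u} u∈U with u ∈? evars Π
... | yes u∈E = contradiction u∈E (Unique-++⇒disjoint (univ Π) (evars Π) unique u∈U)
... | no _    = refl

RespectsDeps : Prefix → (Var → Assignment → Bool) → Set
RespectsDeps Π F = ∀ {x D} → (x , D) ∈ exist Π → DependsOnlyOn D (F x)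

extendAssign-dependsOn : ∀ Π F → RespectsDeps Π F →
                         ∀ x → DependsOnlyOn (dep Π x) (λ τ → extendAssign Π F τ x)
extendAssign-dependsOn Π F F-deps x τ τ′ agree with x ∈? evars Π
... | yes x∈E = F-deps (dep-∈-exist Π x∈E) τ τ′ agree
... | no x∉E  = agree (subst (x ∈_) (sym (dep-∉ Π x∉E)) (here refl))

_[_≔_] : (Var → Assignment → Bool) → Var → (Assignment → Bool) → Var → Assignment → Bool
(F [ v ≔ g ]) x = if does (x ≟ v) then g else F x

update-≢ : ∀ F {v x} g → x ≢ v → (F [ v ≔ g ]) x ≡ F x
update-≢ F {v} {x} g x≢v rewrite dec-false (x ≟ v) x≢v = refl

update-≡ : ∀ F v g → (F [ v ≔ g ]) v ≡ g
update-≡ F v g rewrite dec-true (v ≟ v) refl = refl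

∈-evars-extendPrefix⁻ : ∀ Π v D {x} → x ∈ evars (extendPrefix Π v D) → x ∈ evars Π ⊎ x ≡ v
∈-evars-extendPrefix⁻ Π v D m rewrite map-++ proj₁ (exist Π) ((v , D) ∷ [])
  with ∈-++⁻ (evars Π) m
... | inj₁ x∈E       = inj₁ x∈E
... | inj₂ (here x≡v) = inj₂ x≡v

∈-evars-extendPrefix⁺ : ∀ Π v D {x} → x ∈ evars Π ⊎ x ≡ v → x ∈ evars (extendPrefix Π v D)
∈-evars-extendPrefix⁺ Π v D m rewrite map-++ proj₁ (exist Π) ((v , D) ∷ []) with m
... | inj₁ x∈E  = ∈-++⁺ˡ x∈E
... | inj₂ refl = ∈-++⁺ʳ (evars Π) (here refl)

module _ (Π : Prefix) (F : Var → Assignment → Bool) (v : Var) (D : List Var)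
         (g : Assignment → Bool) (τ : Assignment) where

  extendAssign-extendPrefix-≢ : ∀ {x} → x ≢ v →
    extendAssign (extendPrefix Π v D) (F [ v ≔ g ]) τ x ≡ extendAssign Π F τ x
  extendAssign-extendPrefix-≢ {x} x≢v with x ∈? evars (extendPrefix Π v D) | x ∈? evars Π
  ... | yes _  | yes _   = cong (λ h → h τ) (update-≢ F g x≢v)
  ... | yes x∈ | no x∉E  = [ (λ x∈E → contradiction x∈E x∉E) , (λ x≡v → contradiction x≡v x≢v) ]′
                             (∈-evars-extendPrefix⁻ Π v D x∈)
  ... | no x∉  | yes x∈E = contradiction (∈-evars-extendPrefix⁺ Π v D (inj₁ x∈E)) x∉
  ... | no _   | no _    = refl

  extendAssign-extendPrefix-≡ : extendAssign (extendPrefix Π v D) (F [ v ≔ g ]) τ v ≡ g τ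
  extendAssign-extendPrefix-≡ with v ∈? evars (extendPrefix Π v D)
  ... | yes _  = cong (λ h → h τ) (update-≡ F v g)
  ... | no v∉  = contradiction (∈-evars-extendPrefix⁺ Π v D (inj₂ refl)) v∉

update-dependsOn : ∀ Π F v D g → RespectsDeps Π F → v ∉ evars Π → DependsOnlyOn D g →
                   RespectsDeps (extendPrefix Π v D) (F [ v ≔ g ])
update-dependsOn Π F v D g F-deps v∉E g-dep {D = D′} m with ∈-++⁻ (exist Π) m
... | inj₁ p =
  subst (DependsOnlyOn D′) (sym (update-≢ F g (λ { refl → v∉E (∈-map⁺ proj₁ p) }))) (F-deps p)
... | inj₂ (here refl) = subst (DependsOnlyOn D) (sym (update-≡ F v g)) g-dep

litValue : Lit → Bool
litValue (pos _) = true
litValue (ngt _) = false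

litValue-sound : ∀ l τ → eval τ (litForm l) ≡ true → litValue l ≡ τ (litVar l)
litValue-sound (pos _) τ l-true = sym l-true
litValue-sound (ngt x) τ l-true with τ x
... | false = refl

-- If α mentions a variable more than once, its first literal wins.
force : List Lit → Assignment → Assignment
force []      τ u = τ u
force (l ∷ α) τ u = if does (u ≟ litVar l) then litValue l else force α τ u

force-∈ : ∀ α τ τ′ {u} → u ∈ map litVar α → force α τ u ≡ force α τ′ u
force-∈ (l ∷ α) τ τ′ {u} m with u ≟ litVar l
... | yes u≡l rewrite dec-true (u ≟ litVar l) u≡l = refl
... | no u≢l  rewrite dec-false (u ≟ litVar l) u≢l with m
...   | here u≡l = contradiction u≡l u≢l
...   | there m′ = force-∈ α τ τ′ m′

force-∉ : ∀ α τ {u} → u ∉ map litVar α → force α τ u ≡ τ u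
force-∉ []      τ u∉ = refl
force-∉ (l ∷ α) τ {u} u∉ rewrite dec-false (u ≟ litVar l) (u∉ ∘ here) = force-∉ α τ (u∉ ∘ there)

force-sat : ∀ α τ → eval τ (conj α) ≡ true → ∀ u → force α τ u ≡ τ u
force-sat []      τ _ u = refl
force-sat (l ∷ α) τ α-true u with eval τ (litForm l) in l-true
... | true with u ≟ litVar l
...   | yes refl rewrite dec-true (u ≟ u) refl = litValue-sound l τ l-true
...   | no u≢l   rewrite dec-false (u ≟ litVar l) u≢l = force-sat α τ α-true u

∈-newDep : ∀ Π α Y {l u} → l ∈ Y → u ∈ dep Π (litVar l) → u ∉ map litVar α → u ∈ newDep Π α Y
∈-newDep Π α Y l∈Y u∈D u∉α =
  ∈-filter⁺ (λ u → ¬? (u ∈? map litVar α)) (∈-concatMap⁺ (dep Π ∘ litVar) (lose l∈Y u∈D)) u∉α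

module _ (Π : Prefix) (F : Var → Assignment → Bool)
         (α Y : List Lit) (b : Vec Bool (length Y) → Bool) where

  skolem-v : Assignment → Bool
  skolem-v τ = eval (extendAssign Π F (force α τ)) (applyFn Y b)

  skolem-v-dependsOn : RespectsDeps Π F → DependsOnlyOn (newDep Π α Y) skolem-v
  skolem-v-dependsOn F-deps τ τ′ agree = eval-cong (applyFn Y b) agree-on-Y
    where
    agree-on-dep : ∀ {l u} → l ∈ Y → u ∈ dep Π (litVar l) → force α τ u ≡ force α τ′ u
    agree-on-dep {u = u} l∈Y u∈D with u ∈? map litVar α
    ... | yes u∈α = force-∈ α τ τ′ u∈α
    ... | no u∉α  = begin
      force α τ u   ≡⟨ force-∉ α τ u∉α ⟩
      τ u           ≡⟨ agree (∈-newDep Π α Y l∈Y u∈D u∉α) ⟩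
      τ′ u          ≡⟨ force-∉ α τ′ u∉α ⟨
      force α τ′ u  ∎
      where open ≡-Reasoning

    agree-on-Y : ∀ {x} → x ∈ vars (applyFn Y b) →
                 extendAssign Π F (force α τ) x ≡ extendAssign Π F (force α τ′) x
    agree-on-Y m with ∈-map⁻ litVar (vars-applyFn Y b m)
    ... | l , l∈Y , refl =
      extendAssign-dependsOn Π F F-deps (litVar l) (force α τ) (force α τ′) (agree-on-dep l∈Y)

  skolem-v-sat : RespectsDeps Π F → ∀ τ → eval τ (conj α) ≡ true →
                 skolem-v τ ≡ eval (extendAssign Π F τ) (applyFn Y b)
  skolem-v-sat F-deps τ α-true = eval-cong (applyFn Y b) λ {x} _ →
    extendAssign-dependsOn Π F F-deps x (force α τ) τ (λ {u} _ → force-sat α τ α-true u)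

imp-iff-true : ∀ a c d → (a ≡ true → c ≡ d) → (not a ∨ (if c then d else not d)) ≡ true
imp-iff-true false c     d     _   = refl
imp-iff-true true  c     d     c≡d with refl ← c≡d refl with c
... | true  = refl
... | false = refl

lemma2 : (Π : Prefix) (φ : Form) → WellFormed Π φ → DQBFTrue Π φ →
         (α : List Lit) → (∀ {l} → l ∈ α → litVar l ∈ univ Π) →
         (Y : List Lit) → (∀ {l} → l ∈ Y → litVar l ∈ allVars Π) →
         (b : Vec Bool (length Y) → Bool) →
         (v : Var) → v ∉ allVars Π → v ∉ vars φ →
         DQBFTrue (extendPrefix Π v (newDep Π α Y))
                  (φ and (conj α imp (var v iff applyFn Y b)))
lemma2 Π φ (unique , _ , φ⊆Π) (F , F-deps , F-sat) α α⊆U Y Y⊆Π b v v∉Π _ =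
  F′ , update-dependsOn Π F v Dᵥ gᵥ F-deps (v∉Π ∘ ∈-++⁺ʳ (univ Π))
                         (skolem-v-dependsOn Π F α Y b F-deps)
     , sat
  where
  open ≡-Reasoning
  Dᵥ = newDep Π α Y
  A  = applyFn Y b
  gᵥ = skolem-v Π F α Y b
  F′ = F [ v ≔ gᵥ ]

  sat : ∀ τ → eval (extendAssign (extendPrefix Π v Dᵥ) F′ τ)
                   (φ and (conj α imp (var v iff A))) ≡ true
  sat τ = cong₂ _∧_ φ-true (imp-iff-true (eval σ′ (conj α)) (σ′ v) (eval σ′ A) v-correct)
    where
    σ  = extendAssign Π F τ
    σ′ = extendAssign (extendPrefix Π v Dᵥ) F′ τ

    σ′≗σ : ∀ {x} → x ∈ allVars Π → σ′ x ≡ σ x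
    σ′≗σ x∈Π = extendAssign-extendPrefix-≢ Π F v Dᵥ gᵥ τ (λ { refl → v∉Π x∈Π })

    φ-true : eval σ′ φ ≡ true
    φ-true = trans (eval-cong φ (σ′≗σ ∘ φ⊆Π)) (F-sat τ)

    σ′≗τ-on-α : ∀ {x} → x ∈ vars (conj α) → σ′ x ≡ τ x
    σ′≗τ-on-α m = trans (σ′≗σ (∈-++⁺ˡ x∈U)) (extendAssign-univ Π F τ unique x∈U)
      where x∈U = map-litVar-⊆ α⊆U (vars-conj α m)

    v-correct : eval σ′ (conj α) ≡ true → σ′ v ≡ eval σ′ A
    v-correct α-true = begin
      σ′ v         ≡⟨ extendAssign-extendPrefix-≡ Π F v Dᵥ gᵥ τ ⟩
      gᵥ τ         ≡⟨ skolem-v-sat Π F α Y b F-deps τ α-true-under-τ ⟩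
      eval σ A     ≡⟨ eval-cong A (σ′≗σ ∘ map-litVar-⊆ Y⊆Π ∘ vars-applyFn Y b) ⟨
      eval σ′ A    ∎
      where α-true-under-τ = trans (sym (eval-cong (conj α) σ′≗τ-on-α)) α-true
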